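{- For any integer $d \geq 1$ and any $k, j \in \{0,1,\ldots,d\}$, we have $$c_{d,k}(j) = \sum_{i=0}^k \binom{k}{i} \sum_{\ell=0}^{d-i} |s(d-i+1, \ell+1)|\, s(i, j-\ell).$$
   Context: For integers $d \geq 1$ and $k \in \{0,\ldots,d\}$, let $P_{d,k}$ be the polynomial determined by $\sum_{n \geq 0} P_{d,k}(n)\, x^n = \frac{(1+x)^k}{(1-x)^{d+1}}$ (equivalently $P_{d,k}(n) = \sum_{i=0}^k \binom{k}{i}\binom{n+d-i}{d}$). The numbers $c_{d,k}(j)$ are defined by $d!\, P_{d,k}(n) = \sum_{j=0}^d c_{d,k}(j)\, n^j$. The signed Stirling number of the first kind is $s(m,i) = (-1)^{m-i}\cdot|\{\sigma \in S_m : \sigma \text{ has } i \text{ cycles}\}|$ (so $s(m,i)=0$ when $i<0$ or $i>m$, and $s(0,0)=1$). -}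

module Defs where

open import Data.Nat as ℕ using (ℕ; zero; suc; _∸_)
open import Data.Nat.Combinatorics using (_C_)
open import Data.Nat using (_!)
open import Data.Integer as ℤ using (ℤ; +_; _-_; -[1+_]; ∣_∣)
open import Relation.Binary.PropositionalEquality using (_≡_)

sumZ : ℕ → (ℕ → ℤ) → ℤ
sumZ zero    f = f 0
sumZ (suc n) f = sumZ n f ℤ.+ f (suc n)

sumN : ℕ → (ℕ → ℕ) → ℕ
sumN zero    f = f 0
sumN (suc n) f = sumN n f ℕ.+ f (suc n)

-- Unsigned Stirling numbers of the first kind c(m,i) = #{σ ∈ S_m with i cycles},
-- via the standard recurrence c(m+1,i+1) = c(m,i) + m·c(m,i+1), c(0,0)=1,
-- c(0,i+1)=0, c(m+1,0)=0.
stirling1u : ℕ → ℕ → ℕ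
stirling1u zero    zero    = 1
stirling1u zero    (suc i) = 0
stirling1u (suc m) zero    = 0
stirling1u (suc m) (suc i) = stirling1u m i ℕ.+ m ℕ.* stirling1u m (suc i)

-- Signed Stirling numbers of the first kind s(m,i) = (-1)^(m-i) c(m,i),
-- with integer second argument; s(m,i) = 0 for i < 0 (and for i > m,
-- automatically, since c(m,i) = 0 there).
sign : ℕ → ℤ
sign zero          = + 1
sign (suc zero)    = -[1+ 0 ]
sign (suc (suc n)) = sign n

stirling1 : ℕ → ℤ → ℤ
stirling1 m (+ i)      = sign (m ∸ i) ℤ.* + stirling1u m i
stirling1 m -[1+ _ ]   = + 0

P : ℕ → ℕ → ℕ → ℕ
P d k n = sumN k (λ i → (k C i) ℕ.* ((n ℕ.+ d ∸ i) C d))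

evalPoly : ℕ → (ℕ → ℤ) → ℤ → ℤ
evalPoly d a x = sumZ d (λ j → a j ℤ.* (x ℤ.^ j))

rhs : ℕ → ℕ → ℕ → ℤ
rhs d k j = sumZ k (λ i → + (k C i) ℤ.*
              sumZ (d ∸ i) (λ ℓ → + ∣ stirling1 (d ∸ i ℕ.+ 1) (+ (ℓ ℕ.+ 1)) ∣
                                   ℤ.* stirling1 i (+ j ℤ.- + ℓ)))

-- c is a coefficient sequence of d!·P_{d,k}: d! P_{d,k}(n) = Σ_{j=0}^{d} c(j) n^j for all n.
-- (These coefficients are unique, so this determines c_{d,k}(j) for j ≤ d.)
IsCoeffs : ℕ → ℕ → (ℕ → ℤ) → Set
IsCoeffs d k c = ∀ (n : ℕ) → + ((d !) ℕ.* P d k n) ≡ evalPoly d c (+ n)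

-- The Stirling numbers are the coefficients of Σₜ s(i,t) xᵗ = x(x−1)⋯(x−i+1) and
-- Σₗ |s(m+1,l+1)| xˡ = (x+1)(x+2)⋯(x+m). With m = d − i the inner sum of the formula is therefore
-- the coefficient of xʲ in their product (x−i+1)⋯(x+d−i) = d!·C(x+d−i, d). Weighting by C(k,i)
-- and summing over i gives a polynomial of degree ≤ d that agrees with d!·P_{d,k} on ℕ, and a
-- polynomial of degree ≤ d is determined by its values on ℕ.

module Submission where

open import Defs
open import Data.Nat as ℕ using (ℕ; zero; suc; _∸_; z≤n; s≤s; _!; _≤_; NonZero)
open import Data.Nat.Combinatorics using (_C_; nCk+nC[k+1]≡[n+1]C[k+1]; nC1≡n; k>n⇒nCk≡0)
import Data.Nat.Properties as ℕP
import Data.Nat.Tactic.RingSolver as ℕSolver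
open import Data.Integer as ℤ using (ℤ; +_; -[1+_]; ∣_∣; _+_; _*_; _-_; -_; _^_; 0ℤ; 1ℤ)
open import Data.Integer.Properties
open import Data.Integer.Tactic.RingSolver using (solve-∀)
open import Data.Empty using (⊥-elim)
open import Function using (_∘_)
open import Relation.Nullary using (yes; no)
open import Relation.Binary.PropositionalEquality
open ≡-Reasoning

sumZ-cong : ∀ n {f g : ℕ → ℤ} → (∀ i → i ≤ n → f i ≡ g i) → sumZ n f ≡ sumZ n g
sumZ-cong zero    f≗g = f≗g 0 z≤n
sumZ-cong (suc n) f≗g =
  cong₂ _+_ (sumZ-cong n (λ i i≤n → f≗g i (ℕP.m≤n⇒m≤1+n i≤n))) (f≗g (suc n) ℕP.≤-refl)

sumZ-distrib-+ : ∀ n (f g : ℕ → ℤ) → sumZ n (λ i → f i + g i) ≡ sumZ n f + sumZ n g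
sumZ-distrib-+ zero    f g = refl
sumZ-distrib-+ (suc n) f g rewrite sumZ-distrib-+ n f g =
  interchange (sumZ n f) (sumZ n g) (f (suc n)) (g (suc n))
  where interchange : ∀ a b c d → a + b + (c + d) ≡ a + c + (b + d)
        interchange = solve-∀

sumZ-distrib-- : ∀ n (f g : ℕ → ℤ) → sumZ n (λ i → f i - g i) ≡ sumZ n f - sumZ n g
sumZ-distrib-- zero    f g = refl
sumZ-distrib-- (suc n) f g rewrite sumZ-distrib-- n f g =
  interchange (sumZ n f) (sumZ n g) (f (suc n)) (g (suc n))
  where interchange : ∀ a b c d → a - b + (c - d) ≡ a + c - (b + d)
        interchange = solve-∀

*-distribˡ-sumZ : ∀ n a (f : ℕ → ℤ) → a * sumZ n f ≡ sumZ n (λ i → a * f i)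
*-distribˡ-sumZ zero    a f = refl
*-distribˡ-sumZ (suc n) a f rewrite sym (*-distribˡ-sumZ n a f) = *-distribˡ-+ a (sumZ n f) (f (suc n))

*-distribʳ-sumZ : ∀ n a (f : ℕ → ℤ) → sumZ n f * a ≡ sumZ n (λ i → f i * a)
*-distribʳ-sumZ n a f = begin
  sumZ n f * a               ≡⟨ *-comm (sumZ n f) a ⟩
  a * sumZ n f               ≡⟨ *-distribˡ-sumZ n a f ⟩
  sumZ n (λ i → a * f i)     ≡⟨ sumZ-cong n (λ i _ → *-comm a (f i)) ⟩
  sumZ n (λ i → f i * a)     ∎

sumZ-comm : ∀ m n (f : ℕ → ℕ → ℤ) →
            sumZ m (λ i → sumZ n (λ j → f i j)) ≡ sumZ n (λ j → sumZ m (λ i → f i j))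
sumZ-comm zero    n f = refl
sumZ-comm (suc m) n f rewrite sumZ-comm m n f =
  sym (sumZ-distrib-+ n (λ j → sumZ m (λ i → f i j)) (λ j → f (suc m) j))

sumZ-splitˡ : ∀ n (f : ℕ → ℤ) → sumZ (suc n) f ≡ f 0 + sumZ n (f ∘ suc)
sumZ-splitˡ zero    f = refl
sumZ-splitˡ (suc n) f rewrite sumZ-splitˡ n f = +-assoc (f 0) (sumZ n (f ∘ suc)) (f (suc (suc n)))

sumZ-extend : ∀ n e (f : ℕ → ℤ) → (∀ i → n ℕ.< i → f i ≡ 0ℤ) → sumZ (n ℕ.+ e) f ≡ sumZ n f
sumZ-extend n zero    f f>n≡0 rewrite ℕP.+-identityʳ n = refl
sumZ-extend n (suc e) f f>n≡0
  rewrite ℕP.+-suc n e | sumZ-extend n e f f>n≡0 | f>n≡0 (suc (n ℕ.+ e)) (s≤s (ℕP.m≤m+n n e)) =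
  +-identityʳ _

sumZ-shift : ∀ l n (f : ℕ → ℤ) → (∀ i → i ℕ.< l → f i ≡ 0ℤ) → sumZ (l ℕ.+ n) f ≡ sumZ n (λ t → f (l ℕ.+ t))
sumZ-shift zero    n f f<l≡0 = refl
sumZ-shift (suc l) n f f<l≡0 rewrite sumZ-splitˡ (l ℕ.+ n) f | f<l≡0 0 (s≤s z≤n) =
  trans (+-identityˡ _) (sumZ-shift l n (f ∘ suc) (λ i i<l → f<l≡0 (suc i) (s≤s i<l)))

pos-sumN : ∀ n (f : ℕ → ℕ) → + sumN n f ≡ sumZ n (+_ ∘ f)
pos-sumN zero    f = refl
pos-sumN (suc n) f = trans (pos-+ (sumN n f) (f (suc n))) (cong (_+ + f (suc n)) (pos-sumN n f))

*-distribˡ-sumN : ∀ n a (f : ℕ → ℕ) → a ℕ.* sumN n f ≡ sumN n (λ i → a ℕ.* f i)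
*-distribˡ-sumN zero    a f = refl
*-distribˡ-sumN (suc n) a f =
  trans (ℕP.*-distribˡ-+ a (sumN n f) (f (suc n))) (cong (ℕ._+ a ℕ.* f (suc n)) (*-distribˡ-sumN n a f))

*-distribʳ-sumN : ∀ n a (f : ℕ → ℕ) → sumN n f ℕ.* a ≡ sumN n (λ i → f i ℕ.* a)
*-distribʳ-sumN zero    a f = refl
*-distribʳ-sumN (suc n) a f =
  trans (ℕP.*-distribʳ-+ a (sumN n f) (f (suc n))) (cong (ℕ._+ f (suc n) ℕ.* a) (*-distribʳ-sumN n a f))

sumN-mono-≤ : ∀ n {f g : ℕ → ℕ} → (∀ i → i ≤ n → f i ≤ g i) → sumN n f ≤ sumN n g
sumN-mono-≤ zero    f≤g = f≤g 0 z≤n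
sumN-mono-≤ (suc n) f≤g =
  ℕP.+-mono-≤ (sumN-mono-≤ n (λ i i≤n → f≤g i (ℕP.m≤n⇒m≤1+n i≤n))) (f≤g (suc n) ℕP.≤-refl)

∣sumZ∣≤sumN∣∣ : ∀ n (f : ℕ → ℤ) → ∣ sumZ n f ∣ ≤ sumN n (∣_∣ ∘ f)
∣sumZ∣≤sumN∣∣ zero    f = ℕP.≤-refl
∣sumZ∣≤sumN∣∣ (suc n) f =
  ℕP.≤-trans (∣i+j∣≤∣i∣+∣j∣ (sumZ n f) (f (suc n))) (ℕP.+-monoˡ-≤ ∣ f (suc n) ∣ (∣sumZ∣≤sumN∣∣ n f))

stirling1u-above : ∀ m i → m ℕ.< i → stirling1u m i ≡ 0
stirling1u-above zero    (suc i) _         = refl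
stirling1u-above (suc m) (suc i) (s≤s m<i)
  rewrite stirling1u-above m i m<i | stirling1u-above m (suc i) (ℕP.m≤n⇒m≤1+n m<i) = ℕP.*-zeroʳ m

sign-suc : ∀ n → sign (suc n) ≡ - sign n
sign-suc zero          = refl
sign-suc (suc zero)    = refl
sign-suc (suc (suc n)) = sign-suc n

∣sign∣≡1 : ∀ n → ∣ sign n ∣ ≡ 1
∣sign∣≡1 zero          = refl
∣sign∣≡1 (suc zero)    = refl
∣sign∣≡1 (suc (suc n)) = ∣sign∣≡1 n

∣stirling1∣≡stirling1u : ∀ m i → ∣ stirling1 m (+ i) ∣ ≡ stirling1u m i
∣stirling1∣≡stirling1u m i rewrite abs-* (sign (m ∸ i)) (+ stirling1u m i) | ∣sign∣≡1 (m ∸ i) =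
  ℕP.*-identityˡ _

stirling1-above : ∀ m i → m ℕ.< i → stirling1 m (+ i) ≡ 0ℤ
stirling1-above m i m<i rewrite stirling1u-above m i m<i = *-zeroʳ (sign (m ∸ i))

stirling1-suc : ∀ m t → stirling1 (suc m) (+ suc t) ≡ stirling1 m (+ t) - + m * stirling1 m (+ suc t)
stirling1-suc m t with suc t ℕ.≤? m
... | yes t<m = begin
    sign (m ∸ t) * + (a ℕ.+ m ℕ.* b)
  ≡⟨ cong₂ _*_ flip (trans (pos-+ a (m ℕ.* b)) (cong (λ z → + a + z) (pos-* m b))) ⟩
    - s * (+ a + + m * + b)
  ≡⟨ expand s (+ a) (+ m) (+ b) ⟩
    - s * + a - + m * (s * + b)
  ≡⟨ cong (λ z → z * + a - + m * (s * + b)) (sym flip) ⟩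
    sign (m ∸ t) * + a - + m * (s * + b)
  ∎
  where
  a = stirling1u m t
  b = stirling1u m (suc t)
  s = sign (m ∸ suc t)
  flip : sign (m ∸ t) ≡ - s
  flip = trans (cong sign (ℕP.+-∸-assoc 1 t<m)) (sign-suc (m ∸ suc t))
  expand : ∀ s a M b → - s * (a + M * b) ≡ - s * a - M * (s * b)
  expand = solve-∀
... | no t≮m
  rewrite stirling1u-above m (suc t) (s≤s (ℕP.≮⇒≥ t≮m)) | ℕP.*-zeroʳ m | ℕP.+-identityʳ (stirling1u m t)
        | *-zeroʳ (sign (m ∸ suc t)) | *-zeroʳ (+ m) = sym (+-identityʳ _)

[1+k]*[1+n]C[1+k]≡[1+n]*nCk : ∀ n k → suc k ℕ.* (suc n C suc k) ≡ suc n ℕ.* (n C k)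
[1+k]*[1+n]C[1+k]≡[1+n]*nCk zero    zero    = refl
[1+k]*[1+n]C[1+k]≡[1+n]*nCk zero    (suc k)
  rewrite k>n⇒nCk≡0 {1} {suc (suc k)} (s≤s (s≤s z≤n)) | k>n⇒nCk≡0 {0} {suc k} (s≤s z≤n) =
  ℕP.*-zeroʳ (suc (suc k))
[1+k]*[1+n]C[1+k]≡[1+n]*nCk (suc n) zero rewrite nC1≡n (suc (suc n)) =
  trans (ℕP.+-identityʳ _) (sym (ℕP.*-identityʳ _))
[1+k]*[1+n]C[1+k]≡[1+n]*nCk (suc n) (suc k) = begin
    suc (suc k) ℕ.* (suc (suc n) C suc (suc k))
  ≡⟨ cong (suc (suc k) ℕ.*_) (sym (nCk+nC[k+1]≡[n+1]C[k+1] (suc n) (suc k))) ⟩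
    suc (suc k) ℕ.* (X ℕ.+ Y)
  ≡⟨ regroup k X Y ⟩
    X ℕ.+ (suc k ℕ.* X ℕ.+ suc (suc k) ℕ.* Y)
  ≡⟨ cong₂ (λ u v → X ℕ.+ (u ℕ.+ v))
           ([1+k]*[1+n]C[1+k]≡[1+n]*nCk n k) ([1+k]*[1+n]C[1+k]≡[1+n]*nCk n (suc k)) ⟩
    X ℕ.+ (suc n ℕ.* (n C k) ℕ.+ suc n ℕ.* (n C suc k))
  ≡⟨ cong (X ℕ.+_) (sym (ℕP.*-distribˡ-+ (suc n) (n C k) (n C suc k))) ⟩
    X ℕ.+ suc n ℕ.* (n C k ℕ.+ n C suc k)
  ≡⟨ cong (λ z → X ℕ.+ suc n ℕ.* z) (nCk+nC[k+1]≡[n+1]C[k+1] n k) ⟩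
    X ℕ.+ suc n ℕ.* X
  ∎
  where
  X = suc n C suc k
  Y = suc n C suc (suc k)
  regroup : ∀ k X Y → suc (suc k) ℕ.* (X ℕ.+ Y) ≡ X ℕ.+ (suc k ℕ.* X ℕ.+ suc (suc k) ℕ.* Y)
  regroup = ℕSolver.solve-∀

[1+k]*nC[1+k]≡[n-k]*nCk : ∀ n k → + (suc k ℕ.* (n C suc k)) ≡ (+ n - + k) * + (n C k)
[1+k]*nC[1+k]≡[n-k]*nCk n k = begin
    + (suc k ℕ.* (n C suc k))
  ≡⟨ pos-* (suc k) (n C suc k) ⟩
    + suc k * Q
  ≡⟨ cancel (+ suc k) p Q ⟩
    (+ suc k * p + + suc k * Q) - + suc k * p
  ≡⟨ cong (_- + suc k * p) pascal ⟩
    + suc n * p - + suc k * p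
  ≡⟨ cong₂ (λ u v → u * p - v * p) (pos-+ 1 n) (pos-+ 1 k) ⟩
    (1ℤ + + n) * p - (1ℤ + + k) * p
  ≡⟨ shift (+ n) (+ k) p ⟩
    (+ n - + k) * p
  ∎
  where
  p = + (n C k)
  Q = + (n C suc k)
  pascal : + suc k * p + + suc k * Q ≡ + suc n * p
  pascal = begin
      + suc k * p + + suc k * Q
    ≡⟨ sym (trans (pos-+ (suc k ℕ.* (n C k)) (suc k ℕ.* (n C suc k)))
                  (cong₂ _+_ (pos-* (suc k) (n C k)) (pos-* (suc k) (n C suc k)))) ⟩
      + (suc k ℕ.* (n C k) ℕ.+ suc k ℕ.* (n C suc k))
    ≡⟨ cong +_ (sym (ℕP.*-distribˡ-+ (suc k) (n C k) (n C suc k))) ⟩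
      + (suc k ℕ.* (n C k ℕ.+ n C suc k))
    ≡⟨ cong (λ z → + (suc k ℕ.* z)) (nCk+nC[k+1]≡[n+1]C[k+1] n k) ⟩
      + (suc k ℕ.* (suc n C suc k))
    ≡⟨ cong +_ ([1+k]*[1+n]C[1+k]≡[1+n]*nCk n k) ⟩
      + (suc n ℕ.* (n C k))
    ≡⟨ pos-* (suc n) (n C k) ⟩
      + suc n * p
    ∎
  cancel : ∀ a p q → a * q ≡ (a * p + a * q) - a * p
  cancel = solve-∀
  shift : ∀ n k p → (1ℤ + n) * p - (1ℤ + k) * p ≡ (n - k) * p
  shift = solve-∀

evalPoly-cong : ∀ d {a b : ℕ → ℤ} → (∀ j → j ≤ d → a j ≡ b j) → ∀ x → evalPoly d a x ≡ evalPoly d b x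
evalPoly-cong d a≗b x = sumZ-cong d (λ j j≤d → cong (_* x ^ j) (a≗b j j≤d))

evalPoly-linear : ∀ d k (w : ℕ → ℤ) (g : ℕ → ℕ → ℤ) x →
                  evalPoly d (λ j → sumZ k (λ i → w i * g i j)) x ≡ sumZ k (λ i → w i * evalPoly d (g i) x)
evalPoly-linear d k w g x = begin
    sumZ d (λ j → sumZ k (λ i → w i * g i j) * x ^ j)
  ≡⟨ sumZ-cong d (λ j _ → trans (*-distribʳ-sumZ k (x ^ j) (λ i → w i * g i j))
                                (sumZ-cong k (λ i _ → *-assoc (w i) (g i j) (x ^ j)))) ⟩
    sumZ d (λ j → sumZ k (λ i → w i * (g i j * x ^ j)))
  ≡⟨ sumZ-comm d k (λ j i → w i * (g i j * x ^ j)) ⟩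
    sumZ k (λ i → sumZ d (λ j → w i * (g i j * x ^ j)))
  ≡⟨ sumZ-cong k (λ i _ → sym (*-distribˡ-sumZ d (w i) (λ j → g i j * x ^ j))) ⟩
    sumZ k (λ i → w i * evalPoly d (g i) x)
  ∎

evalPoly-*-linear : ∀ m c (a b : ℕ → ℤ) → b 0 ≡ c * a 0 → (∀ t → b (suc t) ≡ a t + c * a (suc t)) →
                    a (suc m) ≡ 0ℤ → ∀ x → evalPoly (suc m) b x ≡ (x + c) * evalPoly m a x
evalPoly-*-linear m c a b b₀ b₊ aₘ₊₁≡0 x = begin
    evalPoly (suc m) b x
  ≡⟨ sumZ-splitˡ m (λ t → b t * x ^ t) ⟩
    b 0 * 1ℤ + sumZ m (λ t → b (suc t) * x ^ suc t)
  ≡⟨ cong₂ _+_ (cong (_* 1ℤ) b₀) (sumZ-cong m (λ t _ → term t)) ⟩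
    c * a 0 * 1ℤ + sumZ m (λ t → x * (a t * x ^ t) + c * (a (suc t) * x ^ suc t))
  ≡⟨ cong (λ z → c * a 0 * 1ℤ + z) (trans (sumZ-distrib-+ m _ _)
       (sym (cong₂ _+_ (*-distribˡ-sumZ m x (λ t → a t * x ^ t))
                       (*-distribˡ-sumZ m c (λ t → a (suc t) * x ^ suc t))))) ⟩
    c * a 0 * 1ℤ + (x * E + c * S)
  ≡⟨ regroup x c (a 0) E S ⟩
    x * E + c * (a 0 * 1ℤ + S)
  ≡⟨ cong (λ z → x * E + c * z) (trans (sym (sumZ-splitˡ m (λ t → a t * x ^ t))) top-vanishes) ⟩
    x * E + c * E
  ≡⟨ sym (*-distribʳ-+ E x c) ⟩
    (x + c) * E
  ∎
  where
  E = evalPoly m a x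
  S = sumZ m (λ t → a (suc t) * x ^ suc t)
  term : ∀ t → b (suc t) * x ^ suc t ≡ x * (a t * x ^ t) + c * (a (suc t) * x ^ suc t)
  term t = trans (cong (_* x ^ suc t) (b₊ t)) (expand (a t) c (a (suc t)) x (x ^ t))
    where expand : ∀ p c q x y → (p + c * q) * (x * y) ≡ x * (p * y) + c * (q * (x * y))
          expand = solve-∀
  regroup : ∀ x c a₀ E S → c * a₀ * 1ℤ + (x * E + c * S) ≡ x * E + c * (a₀ * 1ℤ + S)
  regroup = solve-∀
  top-vanishes : evalPoly (suc m) a x ≡ E
  top-vanishes = trans (cong (λ z → E + z * x ^ suc m) aₘ₊₁≡0) (+-identityʳ E)

fallingCoeffs : ℕ → ℕ → ℤ
fallingCoeffs i t = stirling1 i (+ t)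

risingCoeffs : ℕ → ℕ → ℤ
risingCoeffs m l = + stirling1u (suc m) (suc l)

evalPoly-fallingCoeffs-suc : ∀ i x → evalPoly (suc i) (fallingCoeffs (suc i)) x ≡ (x - + i) * evalPoly i (fallingCoeffs i) x
evalPoly-fallingCoeffs-suc i = evalPoly-*-linear i (- + i) (fallingCoeffs i) (fallingCoeffs (suc i))
  (constant-term i) (λ t → trans (stirling1-suc i t) (cong (λ z → stirling1 i (+ t) + z) (neg-distribˡ-* (+ i) _)))
  (stirling1-above i (suc i) ℕP.≤-refl)
  where
  constant-term : ∀ i → stirling1 (suc i) (+ 0) ≡ - + i * stirling1 i (+ 0)
  constant-term zero    = refl
  constant-term (suc i) = trans (*-zeroʳ (sign i))
    (sym (trans (cong (- + suc i *_) (*-zeroʳ (sign (suc i)))) (*-zeroʳ (- + suc i))))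

evalPoly-risingCoeffs-suc : ∀ m x → evalPoly (suc m) (risingCoeffs (suc m)) x ≡ (x + + suc m) * evalPoly m (risingCoeffs m) x
evalPoly-risingCoeffs-suc m = evalPoly-*-linear m (+ suc m) (risingCoeffs m) (risingCoeffs (suc m))
  (pos-* (suc m) _)
  (λ t → trans (pos-+ (stirling1u (suc m) (suc t)) (suc m ℕ.* stirling1u (suc m) (suc (suc t))))
                (cong (λ z → risingCoeffs m t + z) (pos-* (suc m) (stirling1u (suc m) (suc (suc t))))))
  (cong +_ (stirling1u-above (suc m) (suc (suc m)) ℕP.≤-refl))

evalPoly-fallingCoeffs : ∀ i n → evalPoly i (fallingCoeffs i) (+ n) ≡ + (i ! ℕ.* (n C i))
evalPoly-fallingCoeffs zero    n = refl
evalPoly-fallingCoeffs (suc i) n = begin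
    evalPoly (suc i) (fallingCoeffs (suc i)) (+ n)
  ≡⟨ evalPoly-fallingCoeffs-suc i (+ n) ⟩
    (+ n - + i) * evalPoly i (fallingCoeffs i) (+ n)
  ≡⟨ cong ((+ n - + i) *_) (trans (evalPoly-fallingCoeffs i n) (pos-* (i !) (n C i))) ⟩
    (+ n - + i) * (+ (i !) * + (n C i))
  ≡⟨ swap (+ n - + i) (+ (i !)) (+ (n C i)) ⟩
    + (i !) * ((+ n - + i) * + (n C i))
  ≡⟨ cong (+ (i !) *_) (sym ([1+k]*nC[1+k]≡[n-k]*nCk n i)) ⟩
    + (i !) * + (suc i ℕ.* (n C suc i))
  ≡⟨ sym (pos-* (i !) _) ⟩
    + (i ! ℕ.* (suc i ℕ.* (n C suc i)))
  ≡⟨ cong +_ (trans (sym (ℕP.*-assoc (i !) (suc i) (n C suc i)))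
                    (cong (ℕ._* (n C suc i)) (ℕP.*-comm (i !) (suc i)))) ⟩
    + (suc i ! ℕ.* (n C suc i))
  ∎
  where
  swap : ∀ a b c → a * (b * c) ≡ b * (a * c)
  swap = solve-∀

evalPoly-rising*falling : ∀ m i n → evalPoly m (risingCoeffs m) (+ n) * evalPoly i (fallingCoeffs i) (+ n)
                                  ≡ + ((m ℕ.+ i) ! ℕ.* ((n ℕ.+ m) C (m ℕ.+ i)))
evalPoly-rising*falling zero    i n rewrite ℕP.+-identityʳ n = trans (*-identityˡ _) (evalPoly-fallingCoeffs i n)
evalPoly-rising*falling (suc m) i n rewrite ℕP.+-suc n m = begin
    evalPoly (suc m) (risingCoeffs (suc m)) (+ n) * F
  ≡⟨ cong (_* F) (evalPoly-risingCoeffs-suc m (+ n)) ⟩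
    (+ n + + suc m) * evalPoly m (risingCoeffs m) (+ n) * F
  ≡⟨ *-assoc (+ n + + suc m) _ F ⟩
    (+ n + + suc m) * (evalPoly m (risingCoeffs m) (+ n) * F)
  ≡⟨ cong₂ _*_ (trans (sym (pos-+ n (suc m))) (cong +_ (ℕP.+-suc n m))) (evalPoly-rising*falling m i n) ⟩
    + suc N * + (r ! ℕ.* (N C r))
  ≡⟨ sym (pos-* (suc N) _) ⟩
    + (suc N ℕ.* (r ! ℕ.* (N C r)))
  ≡⟨ cong +_ absorb ⟩
    + (suc r ! ℕ.* (suc N C suc r))
  ∎
  where
  F = evalPoly i (fallingCoeffs i) (+ n)
  N = n ℕ.+ m
  r = m ℕ.+ i
  absorb : suc N ℕ.* (r ! ℕ.* (N C r)) ≡ suc r ! ℕ.* (suc N C suc r)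
  absorb = begin
    suc N ℕ.* (r ! ℕ.* (N C r))     ≡⟨ swap (suc N) (r !) (N C r) ⟩
    r ! ℕ.* (suc N ℕ.* (N C r))     ≡⟨ cong (r ! ℕ.*_) (sym ([1+k]*[1+n]C[1+k]≡[1+n]*nCk N r)) ⟩
    r ! ℕ.* (suc r ℕ.* (suc N C suc r)) ≡⟨ swap (r !) (suc r) (suc N C suc r) ⟩
    suc r ℕ.* (r ! ℕ.* (suc N C suc r)) ≡⟨ sym (ℕP.*-assoc (suc r) (r !) (suc N C suc r)) ⟩
    suc r ! ℕ.* (suc N C suc r)     ∎
    where swap : ∀ a b c → a ℕ.* (b ℕ.* c) ≡ b ℕ.* (a ℕ.* c)
          swap = ℕSolver.solve-∀

evalPoly-shift : ∀ l m i (b : ℤ → ℤ) → l ≤ m → (∀ t → b -[1+ t ] ≡ 0ℤ) → (∀ t → i ℕ.< t → b (+ t) ≡ 0ℤ) →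
                 ∀ x → evalPoly (m ℕ.+ i) (λ j → b (+ j - + l)) x ≡ x ^ l * evalPoly i (b ∘ +_) x
evalPoly-shift l m i b l≤m b<0≡0 b>i≡0 x = begin
    sumZ (m ℕ.+ i) f
  ≡⟨ cong (λ n → sumZ n f) m+i≡l+[i+[m∸l]] ⟩
    sumZ (l ℕ.+ (i ℕ.+ (m ∸ l))) f
  ≡⟨ sumZ-shift l (i ℕ.+ (m ∸ l)) f f<l≡0 ⟩
    sumZ (i ℕ.+ (m ∸ l)) (λ t → f (l ℕ.+ t))
  ≡⟨ sumZ-cong (i ℕ.+ (m ∸ l)) (λ t _ → f[l+t]≡x^l*g[t] t) ⟩
    sumZ (i ℕ.+ (m ∸ l)) (λ t → x ^ l * g t)
  ≡⟨ sym (*-distribˡ-sumZ (i ℕ.+ (m ∸ l)) (x ^ l) g) ⟩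
    x ^ l * sumZ (i ℕ.+ (m ∸ l)) g
  ≡⟨ cong (x ^ l *_) (sumZ-extend i (m ∸ l) g g>i≡0) ⟩
    x ^ l * evalPoly i (b ∘ +_) x
  ∎
  where
  f g : ℕ → ℤ
  f j = b (+ j - + l) * x ^ j
  g t = b (+ t) * x ^ t
  m+i≡l+[i+[m∸l]] : m ℕ.+ i ≡ l ℕ.+ (i ℕ.+ (m ∸ l))
  m+i≡l+[i+[m∸l]] = trans (cong (ℕ._+ i) (sym (ℕP.m+[n∸m]≡n l≤m))) (reorder l (m ∸ l) i)
    where reorder : ∀ l e i → l ℕ.+ e ℕ.+ i ≡ l ℕ.+ (i ℕ.+ e)
          reorder = ℕSolver.solve-∀
  f<l≡0 : ∀ j → j ℕ.< l → f j ≡ 0ℤ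
  f<l≡0 j j<l = begin
    b (+ j - + l) * x ^ j         ≡⟨ cong (λ z → b z * x ^ j) (trans (m-n≡m⊖n j l) (⊖-< j<l)) ⟩
    b (- + (l ∸ j)) * x ^ j       ≡⟨ cong (λ z → b (- + z) * x ^ j) (ℕP.+-∸-assoc 1 j<l) ⟩
    b -[1+ l ∸ suc j ] * x ^ j    ≡⟨ cong (_* x ^ j) (b<0≡0 (l ∸ suc j)) ⟩
    0ℤ                            ∎
  f[l+t]≡x^l*g[t] : ∀ t → f (l ℕ.+ t) ≡ x ^ l * g t
  f[l+t]≡x^l*g[t] t = begin
      b (+ (l ℕ.+ t) - + l) * x ^ (l ℕ.+ t)
    ≡⟨ cong₂ (λ u v → b u * v) (trans (cong (_- + l) (pos-+ l t)) (cancel (+ l) (+ t))) (^-distribˡ-+-* x l t) ⟩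
      b (+ t) * (x ^ l * x ^ t)
    ≡⟨ swap (b (+ t)) (x ^ l) (x ^ t) ⟩
      x ^ l * g t
    ∎
    where cancel : ∀ l t → l + t - l ≡ t
          cancel = solve-∀
          swap : ∀ a b c → a * (b * c) ≡ b * (a * c)
          swap = solve-∀
  g>i≡0 : ∀ t → i ℕ.< t → g t ≡ 0ℤ
  g>i≡0 t i<t = cong (_* x ^ t) (b>i≡0 t i<t)

evalPoly-convolution : ∀ m i (a : ℕ → ℤ) (b : ℤ → ℤ) → (∀ t → b -[1+ t ] ≡ 0ℤ) → (∀ t → i ℕ.< t → b (+ t) ≡ 0ℤ) →
  ∀ x → evalPoly (m ℕ.+ i) (λ j → sumZ m (λ l → a l * b (+ j - + l))) x ≡ evalPoly m a x * evalPoly i (b ∘ +_) x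
evalPoly-convolution m i a b b<0≡0 b>i≡0 x = begin
    evalPoly (m ℕ.+ i) (λ j → sumZ m (λ l → a l * b (+ j - + l))) x
  ≡⟨ evalPoly-linear (m ℕ.+ i) m a (λ l j → b (+ j - + l)) x ⟩
    sumZ m (λ l → a l * evalPoly (m ℕ.+ i) (λ j → b (+ j - + l)) x)
  ≡⟨ sumZ-cong m (λ l l≤m → cong (a l *_) (evalPoly-shift l m i b l≤m b<0≡0 b>i≡0 x)) ⟩
    sumZ m (λ l → a l * (x ^ l * B))
  ≡⟨ sumZ-cong m (λ l _ → sym (*-assoc (a l) (x ^ l) B)) ⟩
    sumZ m (λ l → a l * x ^ l * B)
  ≡⟨ sym (*-distribʳ-sumZ m B (λ l → a l * x ^ l)) ⟩
    evalPoly m a x * B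
  ∎
  where B = evalPoly i (b ∘ +_) x

binomialCoeffs : ℕ → ℕ → ℕ → ℤ
binomialCoeffs d i j = sumZ (d ∸ i) (λ ℓ → + ∣ stirling1 (d ∸ i ℕ.+ 1) (+ (ℓ ℕ.+ 1)) ∣ * stirling1 i (+ j - + ℓ))

evalPoly-binomialCoeffs : ∀ d i n → i ≤ d → evalPoly d (binomialCoeffs d i) (+ n) ≡ + (d ! ℕ.* ((n ℕ.+ d ∸ i) C d))
evalPoly-binomialCoeffs d i n i≤d = begin
    evalPoly d (binomialCoeffs d i) (+ n)
  ≡⟨ cong (λ D → evalPoly D (binomialCoeffs d i) (+ n)) (sym (ℕP.m∸n+n≡m i≤d)) ⟩
    evalPoly (m ℕ.+ i) (binomialCoeffs d i) (+ n)
  ≡⟨ evalPoly-convolution m i (λ ℓ → + ∣ stirling1 (m ℕ.+ 1) (+ (ℓ ℕ.+ 1)) ∣) (stirling1 i)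
                          (λ _ → refl) (stirling1-above i) (+ n) ⟩
    evalPoly m (λ ℓ → + ∣ stirling1 (m ℕ.+ 1) (+ (ℓ ℕ.+ 1)) ∣) (+ n) * evalPoly i (fallingCoeffs i) (+ n)
  ≡⟨ cong (_* evalPoly i (fallingCoeffs i) (+ n)) (evalPoly-cong m (λ ℓ _ → cong +_ (∣stirling1∣≡risingCoeff ℓ)) (+ n)) ⟩
    evalPoly m (risingCoeffs m) (+ n) * evalPoly i (fallingCoeffs i) (+ n)
  ≡⟨ evalPoly-rising*falling m i n ⟩
    + ((m ℕ.+ i) ! ℕ.* ((n ℕ.+ m) C (m ℕ.+ i)))
  ≡⟨ cong₂ (λ D N → + (D ! ℕ.* (N C D))) (ℕP.m∸n+n≡m i≤d) (sym (ℕP.+-∸-assoc n i≤d)) ⟩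
    + (d ! ℕ.* ((n ℕ.+ d ∸ i) C d))
  ∎
  where
  m = d ∸ i
  ∣stirling1∣≡risingCoeff : ∀ ℓ → ∣ stirling1 (m ℕ.+ 1) (+ (ℓ ℕ.+ 1)) ∣ ≡ stirling1u (suc m) (suc ℓ)
  ∣stirling1∣≡risingCoeff ℓ = trans (cong₂ (λ p q → ∣ stirling1 p (+ q) ∣) (ℕP.+-comm m 1) (ℕP.+-comm ℓ 1))
                                   (∣stirling1∣≡stirling1u (suc m) (suc ℓ))

rhs-isCoeffs : ∀ d k → k ≤ d → IsCoeffs d k (rhs d k)
rhs-isCoeffs d k k≤d n = sym (begin
    evalPoly d (rhs d k) (+ n)
  ≡⟨ evalPoly-linear d k (λ i → + (k C i)) (binomialCoeffs d) (+ n) ⟩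
    sumZ k (λ i → + (k C i) * evalPoly d (binomialCoeffs d i) (+ n))
  ≡⟨ sumZ-cong k (λ i i≤k → cong (+ (k C i) *_) (evalPoly-binomialCoeffs d i n (ℕP.≤-trans i≤k k≤d))) ⟩
    sumZ k (λ i → + (k C i) * + (d ! ℕ.* X i))
  ≡⟨ sumZ-cong k (λ i _ → trans (sym (pos-* (k C i) (d ! ℕ.* X i))) (cong +_ (swap (k C i) (d !) (X i)))) ⟩
    sumZ k (λ i → + (d ! ℕ.* ((k C i) ℕ.* X i)))
  ≡⟨ sym (pos-sumN k (λ i → d ! ℕ.* ((k C i) ℕ.* X i))) ⟩
    + sumN k (λ i → d ! ℕ.* ((k C i) ℕ.* X i))
  ≡⟨ cong +_ (sym (*-distribˡ-sumN k (d !) (λ i → (k C i) ℕ.* X i))) ⟩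
    + (d ! ℕ.* P d k n)
  ∎)
  where
  X : ℕ → ℕ
  X i = (n ℕ.+ d ∸ i) C d
  swap : ∀ a b c → a ℕ.* (b ℕ.* c) ≡ b ℕ.* (a ℕ.* c)
  swap = ℕSolver.solve-∀

∣i^n∣≡∣i∣^n : ∀ i n → ∣ i ^ n ∣ ≡ ∣ i ∣ ℕ.^ n
∣i^n∣≡∣i∣^n i zero    = refl
∣i^n∣≡∣i∣^n i (suc n) = trans (abs-* i (i ^ n)) (cong (∣ i ∣ ℕ.*_) (∣i^n∣≡∣i∣^n i n))

∣evalPoly∣≤ : ∀ d (a : ℕ → ℤ) N .{{_ : NonZero N}} → ∣ evalPoly d a (+ N) ∣ ≤ sumN d (∣_∣ ∘ a) ℕ.* N ℕ.^ d
∣evalPoly∣≤ d a N = ℕP.≤-trans (∣sumZ∣≤sumN∣∣ d (λ j → a j * (+ N) ^ j))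
  (ℕP.≤-trans (sumN-mono-≤ d term≤) (ℕP.≤-reflexive (sym (*-distribʳ-sumN d (N ℕ.^ d) (∣_∣ ∘ a)))))
  where
  term≤ : ∀ j → j ≤ d → ∣ a j * (+ N) ^ j ∣ ≤ ∣ a j ∣ ℕ.* N ℕ.^ d
  term≤ j j≤d rewrite abs-* (a j) ((+ N) ^ j) | ∣i^n∣≡∣i∣^n (+ N) j = ℕP.*-monoʳ-≤ ∣ a j ∣ (ℕP.^-monoʳ-≤ N j≤d)

n*[1+m]≤m⇒n≡0 : ∀ n m → n ℕ.* suc m ≤ m → n ≡ 0
n*[1+m]≤m⇒n≡0 zero    m _  = refl
n*[1+m]≤m⇒n≡0 (suc n) m le = ⊥-elim (ℕP.<⇒≱ (ℕP.n<1+n m) (ℕP.≤-trans (ℕP.m≤n*m (suc m) (suc n)) le))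

-- At N = 1 + Σ_{j ≤ d} |aⱼ| the leading term a_{d+1} N^{d+1} would outweigh all the others.
evalPoly≡0⇒leading≡0 : ∀ d (a : ℕ → ℤ) → (∀ n → evalPoly (suc d) a (+ n) ≡ 0ℤ) → a (suc d) ≡ 0ℤ
evalPoly≡0⇒leading≡0 d a vanishes =
  ∣i∣≡0⇒i≡0 (n*[1+m]≤m⇒n≡0 ∣ a (suc d) ∣ A (ℕP.*-cancelʳ-≤ _ A (N ℕ.^ d) {{ℕP.m^n≢0 N d}} bound))
  where
  A = sumN d (∣_∣ ∘ a)
  N = suc A
  E = evalPoly d a (+ N)
  leading≡-rest : a (suc d) * (+ N) ^ suc d ≡ - E
  leading≡-rest = begin
    a (suc d) * (+ N) ^ suc d                 ≡⟨ isolate E (a (suc d) * (+ N) ^ suc d) ⟩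
    evalPoly (suc d) a (+ N) - E              ≡⟨ cong (_- E) (vanishes N) ⟩
    0ℤ - E                                    ≡⟨ +-identityˡ (- E) ⟩
    - E                                       ∎
    where isolate : ∀ e l → l ≡ (e + l) - e
          isolate = solve-∀
  bound : ∣ a (suc d) ∣ ℕ.* N ℕ.* N ℕ.^ d ≤ A ℕ.* N ℕ.^ d
  bound = ℕP.≤-trans (ℕP.≤-reflexive (begin
      ∣ a (suc d) ∣ ℕ.* N ℕ.* N ℕ.^ d   ≡⟨ ℕP.*-assoc ∣ a (suc d) ∣ N (N ℕ.^ d) ⟩
      ∣ a (suc d) ∣ ℕ.* N ℕ.^ suc d     ≡⟨ cong (∣ a (suc d) ∣ ℕ.*_) (∣i^n∣≡∣i∣^n (+ N) (suc d)) ⟨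
      ∣ a (suc d) ∣ ℕ.* ∣ (+ N) ^ suc d ∣ ≡⟨ abs-* (a (suc d)) ((+ N) ^ suc d) ⟨
      ∣ a (suc d) * (+ N) ^ suc d ∣     ≡⟨ cong ∣_∣ leading≡-rest ⟩
      ∣ - E ∣                           ≡⟨ ∣-i∣≡∣i∣ E ⟩
      ∣ E ∣                             ∎))
    (∣evalPoly∣≤ d a N)

evalPoly≡0⇒coeffs≡0 : ∀ d (a : ℕ → ℤ) → (∀ n → evalPoly d a (+ n) ≡ 0ℤ) → ∀ j → j ≤ d → a j ≡ 0ℤ
evalPoly≡0⇒coeffs≡0 zero    a vanishes zero    _   = trans (sym (*-identityʳ (a 0))) (vanishes 0)
evalPoly≡0⇒coeffs≡0 (suc d) a vanishes j       j≤1+d with j ℕ.≤? d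
... | yes j≤d = evalPoly≡0⇒coeffs≡0 d a lower-vanishes j j≤d
  where
  lower-vanishes : ∀ n → evalPoly d a (+ n) ≡ 0ℤ
  lower-vanishes n = begin
    evalPoly d a (+ n)                               ≡⟨ +-identityʳ _ ⟨
    evalPoly d a (+ n) + 0ℤ * (+ n) ^ suc d          ≡⟨ cong (λ z → evalPoly d a (+ n) + z * (+ n) ^ suc d)
                                                             (evalPoly≡0⇒leading≡0 d a vanishes) ⟨
    evalPoly (suc d) a (+ n)                         ≡⟨ vanishes n ⟩
    0ℤ                                               ∎
... | no j≰d rewrite ℕP.≤-antisym j≤1+d (ℕP.≰⇒> j≰d) = evalPoly≡0⇒leading≡0 d a vanishes

evalPoly-injective : ∀ d (a b : ℕ → ℤ) → (∀ n → evalPoly d a (+ n) ≡ evalPoly d b (+ n)) → ∀ j → j ≤ d → a j ≡ b j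
evalPoly-injective d a b agree j j≤d =
  i-j≡0⇒i≡j (a j) (b j) (evalPoly≡0⇒coeffs≡0 d (λ j → a j - b j) difference-vanishes j j≤d)
  where
  difference-vanishes : ∀ n → evalPoly d (λ j → a j - b j) (+ n) ≡ 0ℤ
  difference-vanishes n = begin
    sumZ d (λ j → (a j - b j) * (+ n) ^ j)
      ≡⟨ sumZ-cong d (λ j _ → distrib (a j) (b j) ((+ n) ^ j)) ⟩
    sumZ d (λ j → a j * (+ n) ^ j - b j * (+ n) ^ j)
      ≡⟨ sumZ-distrib-- d (λ j → a j * (+ n) ^ j) (λ j → b j * (+ n) ^ j) ⟩
    evalPoly d a (+ n) - evalPoly d b (+ n)
      ≡⟨ cong (_- evalPoly d b (+ n)) (agree n) ⟩
    evalPoly d b (+ n) - evalPoly d b (+ n)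
      ≡⟨ +-inverseʳ (evalPoly d b (+ n)) ⟩
    0ℤ
      ∎
    where distrib : ∀ a b y → (a - b) * y ≡ a * y - b * y
          distrib = solve-∀

lemma2p1 : (d k j : ℕ) → 1 ≤ d → k ≤ d → j ≤ d →
    (c : ℕ → ℤ) → IsCoeffs d k c → c j ≡ rhs d k j
lemma2p1 d k j _ k≤d j≤d c isCoeffs = evalPoly-injective d c (rhs d k) agree j j≤d
  where
  agree : ∀ n → evalPoly d c (+ n) ≡ evalPoly d (rhs d k) (+ n)
  agree n = trans (sym (isCoeffs n)) (rhs-isCoeffs d k k≤d n)
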